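{- Let $N_2(n)$ denote the number of pairwise non-isomorphic strong bicentral $2$-trees on $n$ vertices with tail set $\{2,3\}$ (over all possible maximum degrees). Then $N_2(n)\ge n-5$ for all $n\ge 7$.
   Context: A $2$-tree is a graph obtained from the triangle $K_3$ by repeatedly adding a new vertex adjacent to both endpoints of an existing edge. For $r\in\{1,2,3\}$ and an integer $\Delta\ge 2$, a $2$-tree on $n$ vertices is $r$-central with maximum degree $\Delta$ if $\Delta$ is its maximum degree and exactly $r$ vertices have degree $\Delta$; these $r$ vertices form the core and the other $n-r$ vertices form the tail. It is strong if the core induces $K_r$. It has tail set $\{2,3\}$ if every tail vertex has degree $2$ or $3$. "Bicentral" means $2$-central. -}

module Defs where

open import Data.Nat using (ℕ; zero; suc; _≤_; _∸_)
open import Data.Bool using (Bool; true; false; not; _∨_)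
open import Data.Fin using (Fin; zero; suc; _≟_)
open import Data.Fin.Permutation using (Permutation′; _⟨$⟩ʳ_)
open import Data.Vec using (tabulate; sum)
open import Data.Product using (Σ; ∃; _×_; _,_)
open import Data.Sum using (_⊎_)
open import Relation.Nullary using (¬_)
open import Relation.Nullary.Decidable using (isYes)
open import Relation.Binary.PropositionalEquality using (_≡_; _≢_)

-- A (labelled) graph on vertex set Fin n, given by its adjacency relation.
-- (Symmetry/irreflexivity are not imposed here; every 2-tree below is
-- isomorphic to a constructed graph, which is automatically simple.)
Graph : ℕ → Set
Graph n = Fin n → Fin n → Bool

Iso : ∀ {n} → Graph n → Graph n → Set
Iso {n} G H = Σ (Permutation′ n) λ σ → ∀ i j → G i j ≡ H (σ ⟨$⟩ʳ i) (σ ⟨$⟩ʳ j)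

K3 : Graph 3
K3 i j = not (isYes (i ≟ j))

-- Add a new vertex (labelled zero; old vertices shifted by suc)
-- adjacent to exactly u and v.
extend : ∀ {n} → Graph n → Fin n → Fin n → Graph (suc n)
extend G u v zero    zero    = false
extend G u v zero    (suc j) = isYes (j ≟ u) ∨ isYes (j ≟ v)
extend G u v (suc i) zero    = isYes (i ≟ u) ∨ isYes (i ≟ v)
extend G u v (suc i) (suc j) = G i j

data Built : (n : ℕ) → Graph n → Set where
  base : Built 3 K3
  ext  : ∀ {n} {G : Graph n} → Built n G → (u v : Fin n) → G u v ≡ true →
         Built (suc n) (extend G u v)

Is2Tree : ∀ {n} → Graph n → Set
Is2Tree {n} G = ∃ λ H → Built n H × Iso G H

b2n : Bool → ℕ
b2n true  = 1
b2n false = 0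

deg : ∀ {n} → Graph n → Fin n → ℕ
deg G i = sum (tabulate (λ j → b2n (G i j)))

-- G is a strong bicentral 2-tree with tail set {2,3}:
-- maximum degree Δ ≥ 2, exactly two vertices a ≠ b of degree Δ (the core),
-- the core induces K2 (a ~ b), and every tail vertex has degree 2 or 3.
StrongBicentral23 : ∀ {n} → Graph n → Set
StrongBicentral23 {n} G =
  Is2Tree G ×
  Σ ℕ λ Δ → 2 ≤ Δ × (∀ v → deg G v ≤ Δ) ×
  Σ (Fin n) λ a → Σ (Fin n) λ b →
    a ≢ b × deg G a ≡ Δ × deg G b ≡ Δ ×
    (∀ v → deg G v ≡ Δ → v ≡ a ⊎ v ≡ b) ×
    G a b ≡ true ×
    (∀ v → v ≢ a → v ≢ b → deg G v ≡ 2 ⊎ deg G v ≡ 3)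

module Submission where

-- In every graph built here the core {a, b} is an edge whose endpoints have the same degree
-- Δ ≥ 4 while all other vertices have degree 2 or 3, so an isomorphism maps core to core and
-- preserves the number of pages, the common neighbours of a and b of degree 2.  Attaching a
-- new vertex to ab adds a page and raises Δ.  Attaching one to a and to a private degree-2
-- neighbour t of a raises only deg a and turns t into a degree-3 vertex; doing this at both
-- ends raises Δ by one on two new vertices without creating pages.  From page-free graphs on
-- 6 and 9 vertices this yields page-free graphs on every m ≥ 8 vertices.  Adding n − m pages
-- to these, n − 6 pages to the 6-vertex one, and n − 3 pages to the triangle gives n − 5
-- graphs on n vertices with the distinct page counts 0, …, n − 8, n − 6 and n − 2.

open import Defs
open import Data.Bool using (true; false; not; _∧_; _∨_)
import Data.Bool.Properties as Bool
open import Data.Fin using (Fin; zero; suc; _≟_)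
open import Data.Fin.Patterns using (0F; 1F; 2F; 3F; 4F; 5F; 6F; 7F)
open import Data.Fin.Permutation using (Permutation′; _⟨$⟩ʳ_)
import Data.Fin.Permutation as Permutation
open import Data.Fin.Properties using (all?; suc-injective)
open import Data.Nat using (ℕ; zero; suc; _+_; _≤_; _∸_; _≡ᵇ_; z≤n; s≤s)
import Data.Nat as ℕ
open import Data.Nat.Properties using (+-0-commutativeMonoid; ≤-refl; ≤-trans; ≤-reflexive; m≤m+n; <-irrefl; m≤n⇒∃[o]m+o≡n)
import Data.Nat.Properties as ℕ
open import Data.Product using (Σ; _×_; _,_; proj₁; proj₂; map₂)
import Data.Product as Product
open import Data.Sum using (_⊎_; inj₁; inj₂)
open import Data.Vec using (sum; tabulate)
open import Data.Vec.Properties using (tabulate-cong)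
open import Function using (_∘_; Injection)
open import Function.Properties.Inverse using (↔⇒↣)
open import Relation.Nullary using (¬_; Dec; yes; no; ¬?; contradiction)
open import Relation.Nullary.Decidable using (isYes; isYes≗does; dec-true; dec-false; from-yes; _→-dec_; _⊎-dec_)
open import Relation.Binary.PropositionalEquality
open import Algebra.Properties.CommutativeMonoid.Sum +-0-commutativeMonoid
  using () renaming (sum to sumᶠ; sum-permute to sumᶠ-permute)

isYes-≟-refl : ∀ {n} (i : Fin n) → isYes (i ≟ i) ≡ true
isYes-≟-refl i = trans (isYes≗does (i ≟ i)) (dec-true (i ≟ i) refl)

isYes-≟-≢ : ∀ {n} {i j : Fin n} → i ≢ j → isYes (i ≟ j) ≡ false
isYes-≟-≢ {i = i} {j} i≢j = trans (isYes≗does (i ≟ j)) (dec-false (i ≟ j) i≢j)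

isYes-≟-suc : ∀ {n} (i j : Fin n) → isYes (suc i ≟ suc j) ≡ isYes (i ≟ j)
isYes-≟-suc i j = trans (isYes≗does (suc i ≟ suc j)) (sym (isYes≗does (i ≟ j)))

true≢false : true ≢ false
true≢false ()

∑ : ∀ {n} → (Fin n → ℕ) → ℕ
∑ f = sum (tabulate f)

∑-cong : ∀ {n} {f g : Fin n → ℕ} → (∀ j → f j ≡ g j) → ∑ f ≡ ∑ g
∑-cong f≗g = cong sum (tabulate-cong f≗g)

∑-zero : ∀ {n} {f : Fin n → ℕ} → (∀ j → f j ≡ 0) → ∑ f ≡ 0
∑-zero {zero}  _   = refl
∑-zero {suc n} f≗0 = cong₂ _+_ (f≗0 zero) (∑-zero (f≗0 ∘ suc))

∑≡sumᶠ : ∀ {n} (f : Fin n → ℕ) → ∑ f ≡ sumᶠ f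
∑≡sumᶠ {zero}  f = refl
∑≡sumᶠ {suc n} f = cong (f zero +_) (∑≡sumᶠ (f ∘ suc))

∑-permute : ∀ {n} (σ : Permutation′ n) (f : Fin n → ℕ) → ∑ (f ∘ (σ ⟨$⟩ʳ_)) ≡ ∑ f
∑-permute σ f = begin
  ∑ (f ∘ (σ ⟨$⟩ʳ_))    ≡⟨ ∑≡sumᶠ (f ∘ (σ ⟨$⟩ʳ_)) ⟩
  sumᶠ (f ∘ (σ ⟨$⟩ʳ_)) ≡⟨ sumᶠ-permute f σ ⟨
  sumᶠ f               ≡⟨ ∑≡sumᶠ f ⟨
  ∑ f                  ∎
  where open ≡-Reasoning

∑-indicator : ∀ {n} (u : Fin n) → ∑ (λ j → b2n (isYes (j ≟ u))) ≡ 1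
∑-indicator {suc n} zero    = cong suc (∑-zero {n} (λ _ → refl))
∑-indicator {suc n} (suc u) = trans (∑-cong (λ j → cong b2n (isYes-≟-suc j u))) (∑-indicator u)

∑-indicator₂ : ∀ {n} {u v : Fin n} → u ≢ v → ∑ (λ j → b2n (isYes (j ≟ u) ∨ isYes (j ≟ v))) ≡ 2
∑-indicator₂ {u = zero}  {zero}  u≢v = contradiction refl u≢v
∑-indicator₂ {u = zero}  {suc v} _   =
  cong suc (trans (∑-cong (λ j → cong b2n (isYes-≟-suc j v))) (∑-indicator v))
∑-indicator₂ {u = suc u} {zero}  _   =
  cong suc (trans (∑-cong (λ j → cong b2n (trans (Bool.∨-identityʳ _) (isYes-≟-suc j u)))) (∑-indicator u))
∑-indicator₂ {u = suc u} {suc v} u≢v =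
  trans (∑-cong (λ j → cong b2n (cong₂ _∨_ (isYes-≟-suc j u) (isYes-≟-suc j v))))
        (∑-indicator₂ (u≢v ∘ cong suc))

Built⇒irreflexive : ∀ {n G} → Built n G → ∀ v → G v v ≡ false
Built⇒irreflexive base          v       = cong not (isYes-≟-refl v)
Built⇒irreflexive (ext _ _ _ _) zero    = refl
Built⇒irreflexive (ext B _ _ _) (suc v) = Built⇒irreflexive B v

K3-symmetric : ∀ i j → K3 i j ≡ K3 j i
K3-symmetric = from-yes (all? λ i → all? λ j → K3 i j Bool.≟ K3 j i)

Built⇒symmetric : ∀ {n G} → Built n G → ∀ i j → G i j ≡ G j i
Built⇒symmetric base          = K3-symmetric
Built⇒symmetric (ext _ _ _ _) zero    zero    = refl
Built⇒symmetric (ext _ _ _ _) zero    (suc j) = refl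
Built⇒symmetric (ext _ _ _ _) (suc i) zero    = refl
Built⇒symmetric (ext B _ _ _) (suc i) (suc j) = Built⇒symmetric B i j

Built⇒adj⇒≢ : ∀ {n G} → Built n G → ∀ {x y} → G x y ≡ true → x ≢ y
Built⇒adj⇒≢ B {x} x~y refl = true≢false (trans (sym x~y) (Built⇒irreflexive B x))

adj-nonadj⇒≢ : ∀ {n} (G : Graph n) {x i j} → G x i ≡ true → G x j ≡ false → i ≢ j
adj-nonadj⇒≢ _ x~i x≁j refl = true≢false (trans (sym x~i) x≁j)

module _ {n} (G : Graph n) (u v : Fin n) where

  extend-adj-endpoint : ∀ {w} → w ≡ u ⊎ w ≡ v → extend G u v (suc w) zero ≡ true
  extend-adj-endpoint (inj₁ refl) = cong (_∨ isYes (u ≟ v)) (isYes-≟-refl u)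
  extend-adj-endpoint (inj₂ refl) = trans (cong (isYes (v ≟ u) ∨_) (isYes-≟-refl v)) (Bool.∨-zeroʳ (isYes (v ≟ u)))

  extend-nonadj : ∀ {w} → w ≢ u → w ≢ v → extend G u v (suc w) zero ≡ false
  extend-nonadj w≢u w≢v = cong₂ _∨_ (isYes-≟-≢ w≢u) (isYes-≟-≢ w≢v)

  deg-extend-new : u ≢ v → deg (extend G u v) zero ≡ 2
  deg-extend-new = ∑-indicator₂

  deg-extend-endpoint : ∀ {w} → w ≡ u ⊎ w ≡ v → deg (extend G u v) (suc w) ≡ suc (deg G w)
  deg-extend-endpoint {w} e = cong (λ x → b2n x + deg G w) (extend-adj-endpoint e)

  deg-extend-other : ∀ {w} → w ≢ u → w ≢ v → deg (extend G u v) (suc w) ≡ deg G w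
  deg-extend-other {w} w≢u w≢v = cong (λ x → b2n x + deg G w) (extend-nonadj w≢u w≢v)

Tail : ∀ {n} → Graph n → Fin n → Fin n → Set
Tail G a b = ∀ v → v ≢ a → v ≢ b → deg G v ≡ 2 ⊎ deg G v ≡ 3

tail-deg≤3 : ∀ {d} → d ≡ 2 ⊎ d ≡ 3 → d ≤ 3
tail-deg≤3 (inj₁ refl) = s≤s (s≤s z≤n)
tail-deg≤3 (inj₂ refl) = ≤-refl

Attachable : ∀ {n} → Graph n → Fin n → Fin n → Fin n → Set
Attachable G a b w = w ≡ a ⊎ w ≡ b ⊎ deg G w ≡ 2

module _ {n} {G : Graph n} {a b u v : Fin n} (tail : Tail G a b) (u≢v : u ≢ v)
         (attach-u : Attachable G a b u) (attach-v : Attachable G a b v) where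

  private
    attached-tail-deg : ∀ {w} → Attachable G a b w → w ≢ a → w ≢ b → deg G w ≡ 2
    attached-tail-deg (inj₁ w≡a)        w≢a _   = contradiction w≡a w≢a
    attached-tail-deg (inj₂ (inj₁ w≡b)) _   w≢b = contradiction w≡b w≢b
    attached-tail-deg (inj₂ (inj₂ d≡2)) _   _   = d≡2

    endpoint-or-other : ∀ w → (w ≡ u ⊎ w ≡ v) ⊎ (w ≢ u × w ≢ v)
    endpoint-or-other w with w ≟ u | w ≟ v
    ... | yes w≡u | _        = inj₁ (inj₁ w≡u)
    ... | no _    | yes w≡v  = inj₁ (inj₂ w≡v)
    ... | no w≢u  | no w≢v   = inj₂ (w≢u , w≢v)

    attach-endpoint : ∀ {w} → w ≡ u ⊎ w ≡ v → Attachable G a b w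
    attach-endpoint (inj₁ refl) = attach-u
    attach-endpoint (inj₂ refl) = attach-v

  Tail-extend : Tail (extend G u v) (suc a) (suc b)
  Tail-extend zero    _   _   = inj₁ (deg-extend-new G u v u≢v)
  Tail-extend (suc w) w≢a w≢b with endpoint-or-other w
  ... | inj₁ endpoint     = inj₂ (trans (deg-extend-endpoint G u v endpoint)
                                        (cong suc (attached-tail-deg (attach-endpoint endpoint)
                                                                     (w≢a ∘ cong suc) (w≢b ∘ cong suc))))
  ... | inj₂ (w≢u , w≢v) = subst (λ d → d ≡ 2 ⊎ d ≡ 3) (sym (deg-extend-other G u v w≢u w≢v))
                                 (tail w (w≢a ∘ cong suc) (w≢b ∘ cong suc))

pages : ∀ {n} → Graph n → Fin n → Fin n → ℕ
pages G x y = ∑ (λ j → b2n ((G x j ∧ G y j) ∧ (deg G j ≡ᵇ 2)))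

pages-sym : ∀ {n} (G : Graph n) x y → pages G x y ≡ pages G y x
pages-sym G x y = ∑-cong (λ j → cong (λ c → b2n (c ∧ (deg G j ≡ᵇ 2))) (Bool.∧-comm (G x j) (G y j)))

record Core (n da db : ℕ) : Set where
  field
    G     : Graph n
    built : Built n G
    a b   : Fin n
    ab    : G a b ≡ true
    deg-a : deg G a ≡ da
    deg-b : deg G b ≡ db
    tail  : Tail G a b

  a≢b : a ≢ b
  a≢b = Built⇒adj⇒≢ built ab

  pageCount : ℕ
  pageCount = pages G a b

  vertex-cases : ∀ v → v ≡ a ⊎ v ≡ b ⊎ deg G v ≤ 3
  vertex-cases v with v ≟ a | v ≟ b
  ... | yes v≡a | _       = inj₁ v≡a
  ... | no _    | yes v≡b = inj₂ (inj₁ v≡b)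
  ... | no v≢a  | no v≢b  = inj₂ (inj₂ (tail-deg≤3 (tail v v≢a v≢b)))

  high-degree⇒core : ∀ {v} → 4 ≤ deg G v → v ≡ a ⊎ v ≡ b
  high-degree⇒core {v} 4≤deg with vertex-cases v
  ... | inj₁ v≡a        = inj₁ v≡a
  ... | inj₂ (inj₁ v≡b) = inj₂ v≡b
  ... | inj₂ (inj₂ ≤3)  = contradiction (≤-trans 4≤deg ≤3) (<-irrefl refl)

swapCore : ∀ {n da db} → Core n da db → Core n db da
swapCore c = record
  { G = G ; built = built ; a = b ; b = a
  ; ab = trans (Built⇒symmetric built b a) ab
  ; deg-a = deg-b ; deg-b = deg-a
  ; tail = λ v v≢b v≢a → tail v v≢a v≢b
  }
  where open Core c

addPage : ∀ {n da db} → Core n da db → Core (suc n) (suc da) (suc db)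
addPage c = record
  { G = extend G a b ; built = ext built a b ab ; a = suc a ; b = suc b ; ab = ab
  ; deg-a = trans (deg-extend-endpoint G a b (inj₁ refl)) (cong suc deg-a)
  ; deg-b = trans (deg-extend-endpoint G a b (inj₂ refl)) (cong suc deg-b)
  ; tail = Tail-extend tail a≢b (inj₁ refl) (inj₂ (inj₁ refl))
  }
  where open Core c

pageCount-addPage : ∀ {n da db} (c : Core n da db) → Core.pageCount (addPage c) ≡ suc (Core.pageCount c)
pageCount-addPage c = cong₂ _+_ new-page (∑-cong (cong b2n ∘ old-vertex))
  where
  open Core c
  G′ = extend G a b

  new-page : b2n ((G′ (suc a) zero ∧ G′ (suc b) zero) ∧ (deg G′ zero ≡ᵇ 2)) ≡ 1
  new-page rewrite extend-adj-endpoint G a b (inj₁ refl) | extend-adj-endpoint G a b (inj₂ refl)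
                 | deg-extend-new G a b a≢b = refl

  old-vertex : ∀ j → (G a j ∧ G b j) ∧ (deg G′ (suc j) ≡ᵇ 2) ≡ (G a j ∧ G b j) ∧ (deg G j ≡ᵇ 2)
  old-vertex j with G a j in a~j | G b j in b~j
  ... | false | _     = refl
  ... | true  | false = refl
  ... | true  | true  = cong (_≡ᵇ 2) (deg-extend-other G a b (≢-sym (Built⇒adj⇒≢ built a~j))
                                                              (≢-sym (Built⇒adj⇒≢ built b~j)))

record PrivateLeaf {n} (G : Graph n) (a b t : Fin n) : Set where
  field
    adj    : G a t ≡ true
    nonadj : G b t ≡ false
    t≢b    : t ≢ b
    deg-t  : deg G t ≡ 2

CommonNeighboursDeg3 : ∀ {n} → Graph n → Fin n → Fin n → Set
CommonNeighboursDeg3 G a b = ∀ v → G a v ≡ true → G b v ≡ true → deg G v ≡ 3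

record Fanned (n da db : ℕ) : Set where
  field
    core : Core n da db
  open Core core
  field
    ta tb       : Fin n
    leaf-a      : PrivateLeaf G a b ta
    leaf-b      : PrivateLeaf G b a tb
    common-deg3 : CommonNeighboursDeg3 G a b

swapFanned : ∀ {n da db} → Fanned n da db → Fanned n db da
swapFanned f = record
  { core = swapCore core ; ta = tb ; tb = ta ; leaf-a = leaf-b ; leaf-b = leaf-a
  ; common-deg3 = λ v b~v a~v → common-deg3 v a~v b~v
  }
  where open Fanned f

fan : ∀ {n da db} → Fanned n da db → Fanned (suc n) (suc da) db
fan f = record
  { core = record
    { G = G′ ; built = ext built a ta adj ; a = suc a ; b = suc b ; ab = ab
    ; deg-a = trans (deg-extend-endpoint G a ta (inj₁ refl)) (cong suc deg-a)
    ; deg-b = trans (deg-extend-other G a ta b≢a b≢ta) deg-b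
    ; tail = Tail-extend tail a≢ta (inj₁ refl) (inj₂ (inj₂ deg-t))
    }
  ; ta = zero
  ; tb = suc tb
  ; leaf-a = record
    { adj = extend-adj-endpoint G a ta (inj₁ refl) ; nonadj = extend-nonadj G a ta b≢a b≢ta
    ; t≢b = λ () ; deg-t = deg-extend-new G a ta a≢ta
    }
  ; leaf-b = record
    { adj = B.adj ; nonadj = B.nonadj ; t≢b = B.t≢b ∘ suc-injective
    ; deg-t = trans (deg-extend-other G a ta B.t≢b tb≢ta) B.deg-t
    }
  ; common-deg3 = common-deg3′
  }
  where
  open Fanned f
  open Core core
  open PrivateLeaf leaf-a
  module B = PrivateLeaf leaf-b
  G′ = extend G a ta
  a≢ta = Built⇒adj⇒≢ built adj
  b≢a = ≢-sym a≢b
  b≢ta = ≢-sym t≢b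
  tb≢ta = ≢-sym (adj-nonadj⇒≢ G adj B.nonadj)

  common-deg3′ : CommonNeighboursDeg3 G′ (suc a) (suc b)
  common-deg3′ zero    _   b~new = contradiction (trans (sym b~new) (extend-nonadj G a ta b≢a b≢ta)) true≢false
  common-deg3′ (suc w) a~w b~w   =
    trans (deg-extend-other G a ta (≢-sym (Built⇒adj⇒≢ built a~w)) (adj-nonadj⇒≢ G b~w nonadj))
          (common-deg3 w a~w b~w)

fanBoth : ∀ {n Δ} → Fanned n Δ Δ → Fanned (2 + n) (suc Δ) (suc Δ)
fanBoth = swapFanned ∘ fan ∘ swapFanned ∘ fan

pageCount-fanned : ∀ {n da db} (f : Fanned n da db) → Core.pageCount (Fanned.core f) ≡ 0
pageCount-fanned f = ∑-zero no-page
  where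
  open Fanned f
  open Core core

  no-page : ∀ j → b2n ((G a j ∧ G b j) ∧ (deg G j ≡ᵇ 2)) ≡ 0
  no-page j with G a j in a~j | G b j in b~j
  ... | false | _     = refl
  ... | true  | false = refl
  ... | true  | true  rewrite common-deg3 j a~j b~j = refl

tail? : ∀ {n} (G : Graph n) a b → Dec (Tail G a b)
tail? G a b = all? λ v → ¬? (v ≟ a) →-dec ¬? (v ≟ b) →-dec (deg G v ℕ.≟ 2 ⊎-dec deg G v ℕ.≟ 3)

commonNeighboursDeg3? : ∀ {n} (G : Graph n) a b → Dec (CommonNeighboursDeg3 G a b)
commonNeighboursDeg3? G a b = all? λ v → G a v Bool.≟ true →-dec G b v Bool.≟ true →-dec deg G v ℕ.≟ 3

triangle : Core 3 2 2
triangle = record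
  { G = K3 ; built = base ; a = 0F ; b = 1F ; ab = refl ; deg-a = refl ; deg-b = refl
  ; tail = from-yes (tail? K3 0F 1F)
  }

book : (k : ℕ) → Core (3 + k) (2 + k) (2 + k)
book zero    = triangle
book (suc k) = addPage (book k)

fanned6 : Fanned 6 4 4
fanned6 = record
  { core = record
    { G = G ; built = proj₂ built ; a = 3F ; b = 4F ; ab = refl ; deg-a = refl ; deg-b = refl
    ; tail = from-yes (tail? G 3F 4F)
    }
  ; ta = 1F ; tb = 0F
  ; leaf-a = record { adj = refl ; nonadj = refl ; t≢b = λ () ; deg-t = refl }
  ; leaf-b = record { adj = refl ; nonadj = refl ; t≢b = λ () ; deg-t = refl }
  ; common-deg3 = from-yes (commonNeighboursDeg3? G 3F 4F)
  }
  where
  built : Σ (Graph 6) (Built 6)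
  built = _ , ext (ext (ext base 0F 1F refl) 1F 3F refl) 3F 1F refl
  G = proj₁ built

fanned9 : Fanned 9 6 6
fanned9 = record
  { core = record
    { G = G ; built = proj₂ built ; a = 6F ; b = 7F ; ab = refl ; deg-a = refl ; deg-b = refl
    ; tail = from-yes (tail? G 6F 7F)
    }
  ; ta = 2F ; tb = 0F
  ; leaf-a = record { adj = refl ; nonadj = refl ; t≢b = λ () ; deg-t = refl }
  ; leaf-b = record { adj = refl ; nonadj = refl ; t≢b = λ () ; deg-t = refl }
  ; common-deg3 = from-yes (commonNeighboursDeg3? G 6F 7F)
  }
  where
  built : Σ (Graph 9) (Built 9)
  built = _ , ext (ext (ext (ext (ext (ext base 0F 1F refl) 1F 2F refl) 2F 4F refl) 3F 1F refl) 5F 3F refl) 6F 0F refl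
  G = proj₁ built

fannedOfSize : (d : ℕ) → Σ ℕ λ e → Fanned (8 + d) (4 + e) (4 + e)
fannedOfSize 0             = 1 , fanBoth fanned6
fannedOfSize 1             = 2 , fanned9
fannedOfSize (suc (suc d)) = Product.map suc fanBoth (fannedOfSize d)

deg-iso : ∀ {n} (G H : Graph n) ((σ , _) : Iso G H) → ∀ i → deg G i ≡ deg H (σ ⟨$⟩ʳ i)
deg-iso G H (σ , σ-adj) i =
  trans (∑-cong (λ j → cong b2n (σ-adj i j))) (∑-permute σ (λ j → b2n (H (σ ⟨$⟩ʳ i) j)))

pages-iso : ∀ {n} (G H : Graph n) ((σ , _) : Iso G H) → ∀ x y → pages G x y ≡ pages H (σ ⟨$⟩ʳ x) (σ ⟨$⟩ʳ y)
pages-iso G H iso@(σ , σ-adj) x y = trans (∑-cong (cong b2n ∘ transport)) (∑-permute σ page-in-H)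
  where
  page-in-H : Fin _ → ℕ
  page-in-H j = b2n ((H (σ ⟨$⟩ʳ x) j ∧ H (σ ⟨$⟩ʳ y) j) ∧ (deg H j ≡ᵇ 2))

  transport : ∀ j → (G x j ∧ G y j) ∧ (deg G j ≡ᵇ 2)
                  ≡ (H (σ ⟨$⟩ʳ x) (σ ⟨$⟩ʳ j) ∧ H (σ ⟨$⟩ʳ y) (σ ⟨$⟩ʳ j)) ∧ (deg H (σ ⟨$⟩ʳ j) ≡ᵇ 2)
  transport j = cong₂ _∧_ (cong₂ _∧_ (σ-adj x j) (σ-adj y j)) (cong (_≡ᵇ 2) (deg-iso G H iso j))

-- The core degree is 4 + e, above every tail degree, so the core is visible in the degrees.
Candidate : ℕ → Set
Candidate n = Σ ℕ λ e → Core n (4 + e) (4 + e)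

graph : ∀ {n} → Candidate n → Graph n
graph (_ , c) = Core.G c

candidatePages : ∀ {n} → Candidate n → ℕ
candidatePages (_ , c) = Core.pageCount c

candidate-strongBicentral23 : ∀ {n} (c : Candidate n) → StrongBicentral23 (graph c)
candidate-strongBicentral23 (e , c) =
  (G , built , Permutation.id , λ _ _ → refl) , 4 + e , s≤s (s≤s z≤n) , deg≤Δ , a , b , a≢b , deg-a , deg-b ,
  (λ v deg≡Δ → high-degree⇒core (≤-trans (m≤m+n 4 e) (≤-reflexive (sym deg≡Δ)))) , ab , tail
  where
  open Core c
  deg≤Δ : ∀ v → deg G v ≤ 4 + e
  deg≤Δ v with vertex-cases v
  ... | inj₁ refl        = ≤-reflexive deg-a
  ... | inj₂ (inj₁ refl) = ≤-reflexive deg-b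
  ... | inj₂ (inj₂ ≤3)   = ≤-trans ≤3 (m≤m+n 3 (suc e))

candidatePages-iso : ∀ {n} (c c′ : Candidate n) → Iso (graph c) (graph c′) → candidatePages c ≡ candidatePages c′
candidatePages-iso (e , c) (_ , c′) iso@(σ , _) =
  by-core-images (C′.high-degree⇒core (image-high-degree C.deg-a))
                 (C′.high-degree⇒core (image-high-degree C.deg-b))
  where
  module C = Core c
  module C′ = Core c′
  σ-pages = pages-iso C.G C′.G iso C.a C.b

  image-high-degree : ∀ {v} → deg C.G v ≡ 4 + e → 4 ≤ deg C′.G (σ ⟨$⟩ʳ v)
  image-high-degree {v} deg≡ = ≤-trans (m≤m+n 4 e) (≤-reflexive (trans (sym deg≡) (deg-iso C.G C′.G iso v)))

  by-core-images : σ ⟨$⟩ʳ C.a ≡ C′.a ⊎ σ ⟨$⟩ʳ C.a ≡ C′.b → σ ⟨$⟩ʳ C.b ≡ C′.a ⊎ σ ⟨$⟩ʳ C.b ≡ C′.b →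
                   C.pageCount ≡ C′.pageCount
  by-core-images (inj₁ σa≡a′) (inj₂ σb≡b′) = trans σ-pages (cong₂ (pages C′.G) σa≡a′ σb≡b′)
  by-core-images (inj₂ σa≡b′) (inj₁ σb≡a′) =
    trans σ-pages (trans (cong₂ (pages C′.G) σa≡b′ σb≡a′) (pages-sym C′.G C′.b C′.a))
  by-core-images (inj₁ σa≡a′) (inj₁ σb≡a′) = contradiction (Injection.injective (↔⇒↣ σ) (trans σa≡a′ (sym σb≡a′))) C.a≢b
  by-core-images (inj₂ σa≡b′) (inj₂ σb≡b′) = contradiction (Injection.injective (↔⇒↣ σ) (trans σa≡b′ (sym σb≡b′))) C.a≢b

-- family d k has k pages for k < d, d + 5 pages for k = d and d + 1 pages for k = d + 1.
family : (d : ℕ) → Fin (2 + d) → Candidate (7 + d)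
family zero    0F      = 2 , book 4
family zero    1F      = 1 , addPage (Fanned.core fanned6)
family (suc d) zero    = map₂ Fanned.core (fannedOfSize d)
family (suc d) (suc k) = Product.map suc addPage (family d k)

family-pages-zero : ∀ d → candidatePages (family (suc d) zero) ≡ 0
family-pages-zero d = pageCount-fanned (proj₂ (fannedOfSize d))

family-pages-suc : ∀ d k → candidatePages (family (suc d) (suc k)) ≡ suc (candidatePages (family d k))
family-pages-suc d k = pageCount-addPage (proj₂ (family d k))

family-pages-injective : ∀ d {k l} → candidatePages (family d k) ≡ candidatePages (family d l) → k ≡ l
family-pages-injective zero    {0F}    {0F}    _  = refl
family-pages-injective zero    {0F}    {1F}    ()
family-pages-injective zero    {1F}    {0F}    ()
family-pages-injective zero    {1F}    {1F}    _  = refl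
family-pages-injective (suc d) {zero}  {zero}  _  = refl
family-pages-injective (suc d) {zero}  {suc l} eq =
  contradiction (trans (sym (family-pages-zero d)) (trans eq (family-pages-suc d l))) ℕ.0≢1+n
family-pages-injective (suc d) {suc k} {zero}  eq =
  contradiction (trans (sym (family-pages-zero d)) (trans (sym eq) (family-pages-suc d k))) ℕ.0≢1+n
family-pages-injective (suc d) {suc k} {suc l} eq =
  cong suc (family-pages-injective d (ℕ.suc-injective
    (trans (sym (family-pages-suc d k)) (trans eq (family-pages-suc d l)))))

theorem4p13 : (n : ℕ) → 7 ≤ n →
    Σ (Fin (n ∸ 5) → Graph n) λ gs →
      (∀ k → StrongBicentral23 (gs k)) ×
      (∀ k l → k ≢ l → ¬ Iso (gs k) (gs l))
theorem4p13 n 7≤n with m≤n⇒∃[o]m+o≡n 7≤n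
... | d , refl =
  graph ∘ family d ,
  candidate-strongBicentral23 ∘ family d ,
  λ k l k≢l iso → k≢l (family-pages-injective d (candidatePages-iso (family d k) (family d l) iso))
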